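{- Let $G=(V,E)$ be an undirected graph with edges ordered $e_1,\dots,e_m$ ($m=|E|$), and let $\ell\in\mathbb{N}$ with $\ell\ge2$. Let $D$ be the digraph with nodes $z_1,\dots,z_{m+1}$, source $s:=z_1$, sink $t:=z_{m+1}$, whose arc set $A$ is the union of bundles $A_1,\dots,A_m$, where $A_i$ consists of $\ell$ parallel arcs from $z_i$ to $z_{i+1}$; for each $i$ with $e_i=\{v,w\}$ fix two distinct arcs $a_{iv},a_{iw}\in A_i$. Let $H=(A,E_H)$ with $E_H:=\{\{a_{iv},a_{jv}\}: i,j\in[m],\ i\ne j,\ v\in e_i\cap e_j\}$. Then there is an $s$-$t$-path flow $x$ in $D$ respecting unit capacities with $\sum_{P\in\mathcal{P}}x_P=\ell$ and $\max_{S\in\mathcal{S}_{H,2}}\lambda(x,S)\le1$ if and only if $\chi_f(G)\le\ell$.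
   Context: $\mathcal{P}$ is the set of $s$-$t$-paths in $D$ (each identified with its arc set); a path flow respecting unit capacities is $x\in\mathbb{Q}_+^{\mathcal{P}}$ with $\sum_{P\ni a}x_P\le1$ for all $a\in A$. For $S\subseteq A$, $\lambda(x,S):=\sum_{P\in\mathcal{P}:P\cap S\ne\emptyset}x_P$, and $\mathcal{S}_{H,2}:=\{S\subseteq A:|S|\le2,\ S\text{ a clique in }H\}$. The fractional chromatic number is $\chi_f(G):=\min\{\sum_{I\in\mathcal{I}(G)}y_I:\ \sum_{I\in\mathcal{I}(G):v\in I}y_I=1\ \forall v\in V,\ y\ge0\}$, where $\mathcal{I}(G)$ is the set of nonempty independent sets of $G$. -}

module Defs where

open import Data.Nat using (ℕ; zero; suc)
open import Data.Bool using (Bool; true; false)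
open import Data.Fin using (Fin)
open import Data.Fin.Subset using (Subset; _∈_; Nonempty)
open import Data.Fin.Subset.Properties using (_∈?_)
open import Data.Vec using (Vec; []; _∷_; lookup)
open import Data.List using (List; []; _∷_; map; concatMap; filter; allFin; foldr)
open import Data.List.Relation.Unary.Any using (Any; any?)
open import Data.Product using (Σ; ∃; _×_; _,_; proj₁; proj₂)
open import Data.Sum using (_⊎_)
open import Data.Integer using (+_)
open import Data.Rational using (ℚ; 0ℚ; 1ℚ; _+_; _≤_; _/_)
open import Relation.Binary.PropositionalEquality using (_≡_; _≢_)
open import Relation.Nullary using (¬_; Dec)
import Data.Fin as F

allVecs : {X : Set} → List X → (m : ℕ) → List (Vec X m)
allVecs xs zero    = [] ∷ []
allVecs xs (suc m) = concatMap (λ k → map (k ∷_) (allVecs xs m)) xs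

sumℚ : List ℚ → ℚ
sumℚ = foldr _+_ 0ℚ

ℕtoℚ : ℕ → ℚ
ℕtoℚ k = (+ k) / 1

-- The graph G = (V, E): V = Fin n, edges ordered e_1..e_m as e : Fin m → Fin n × Fin n

SameEdge : {n : ℕ} → Fin n × Fin n → Fin n × Fin n → Set
SameEdge (u , v) (u' , v') = (u ≡ u' × v ≡ v') ⊎ (u ≡ v' × v ≡ u')

SimpleEdges : {n m : ℕ} → (Fin m → Fin n × Fin n) → Set
SimpleEdges {n} {m} e =
  (∀ i → proj₁ (e i) ≢ proj₂ (e i)) × (∀ i j → SameEdge (e i) (e j) → i ≡ j)

Adj : {n m : ℕ} → (Fin m → Fin n × Fin n) → Fin n → Fin n → Set
Adj {n} {m} e u v = Σ (Fin m) λ i → SameEdge (e i) (u , v)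

Independent : {n m : ℕ} → (Fin m → Fin n × Fin n) → Subset n → Set
Independent e I = ∀ u v → u ∈ I → v ∈ I → ¬ Adj e u v

InIG : {n m : ℕ} → (Fin m → Fin n × Fin n) → Subset n → Set
InIG e I = Nonempty I × Independent e I

allSubsets : (n : ℕ) → List (Subset n)
allSubsets n = allVecs (true ∷ false ∷ []) n

-- χ_f(G) ≤ ℓ : some feasible y of the fractional colouring LP has value ≤ ℓ.
-- y is indexed by all subsets, and required to vanish outside 𝓘(G)
-- (equivalent to y ∈ ℚ₊^{𝓘(G)} extended by zero).
FracChromLe : {n m : ℕ} → (Fin m → Fin n × Fin n) → ℕ → Set
FracChromLe {n} e ℓ =
  Σ (Subset n → ℚ) λ y →
    (∀ I → 0ℚ ≤ y I) ×
    (∀ I → ¬ InIG e I → y I ≡ 0ℚ) ×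
    (∀ v → sumℚ (map y (filter (v ∈?_) (allSubsets n))) ≡ 1ℚ) ×
    sumℚ (map y (allSubsets n)) ≤ ℕtoℚ ℓ

-- An arc is (i , k) : the k-th arc of bundle A_i.
-- An s-t path in D traverses every bundle exactly once, so it is identified
-- with the choice of one arc per bundle: a vector P with P[i] ∈ Fin ℓ.

Arc : ℕ → ℕ → Set
Arc m ℓ = Fin m × Fin ℓ

Path : ℕ → ℕ → Set
Path m ℓ = Vec (Fin ℓ) m

_∈P_ : {m ℓ : ℕ} → Arc m ℓ → Path m ℓ → Set
(i , k) ∈P P = lookup P i ≡ k

_∈P?_ : {m ℓ : ℕ} → (a : Arc m ℓ) → (P : Path m ℓ) → Dec (a ∈P P)
(i , k) ∈P? P = lookup P i F.≟ k

allPaths : (m ℓ : ℕ) → List (Path m ℓ)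
allPaths m ℓ = allVecs (allFin ℓ) m

IsPathFlow : {m ℓ : ℕ} → (Path m ℓ → ℚ) → Set
IsPathFlow {m} {ℓ} x =
  (∀ P → 0ℚ ≤ x P) ×
  (∀ (a : Arc m ℓ) → sumℚ (map x (filter (a ∈P?_) (allPaths m ℓ))) ≤ 1ℚ)

flowValue : {m ℓ : ℕ} → (Path m ℓ → ℚ) → ℚ
flowValue {m} {ℓ} x = sumℚ (map x (allPaths m ℓ))

lam : {m ℓ : ℕ} → (Path m ℓ → ℚ) → List (Arc m ℓ) → ℚ
lam {m} {ℓ} x S =
  sumℚ (map x (filter (λ P → any? (λ a → a ∈P? P) S) (allPaths m ℓ)))

-- The conflict graph H on A.
-- c i = (arc index of a_{i,u}, arc index of a_{i,w}) where e i = (u , w).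

IsArcOf : {n m ℓ : ℕ} → (Fin m → Fin n × Fin n) → (Fin m → Fin ℓ × Fin ℓ)
          → Fin m → Fin n → Fin ℓ → Set
IsArcOf e c i v k =
  (v ≡ proj₁ (e i) × k ≡ proj₁ (c i)) ⊎ (v ≡ proj₂ (e i) × k ≡ proj₂ (c i))

HEdge : {n m ℓ : ℕ} → (Fin m → Fin n × Fin n) → (Fin m → Fin ℓ × Fin ℓ)
        → Arc m ℓ → Arc m ℓ → Set
HEdge {n} e c (i , k) (j , k') =
  i ≢ j × Σ (Fin n) λ v → IsArcOf e c i v k × IsArcOf e c j v k'

-- S ∈ 𝓢_{H,2}: cliques of H of size at most 2 (∅, singletons, edges of H)
data Clique2 {n m ℓ : ℕ} (e : Fin m → Fin n × Fin n) (c : Fin m → Fin ℓ × Fin ℓ)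
     : List (Arc m ℓ) → Set where
  empty  : Clique2 e c []
  single : ∀ a → Clique2 e c (a ∷ [])
  pair   : ∀ a b → HEdge e c a b → Clique2 e c (a ∷ b ∷ [])

-- A path flow of value ℓ saturates every arc, since each path uses exactly one of the ℓ unit-capacity
-- arcs of every bundle. For an edge {a_{iv}, a_{jv}} of H the bound λ(x, {a_{iv}, a_{jv}}) ≤ 1 then
-- leaves no flow on the paths through a_{iv} that avoid a_{jv}. Anchoring every vertex at one of its
-- arcs, the vertices whose arcs all lie on a path P therefore form an independent set, and weighting
-- these sets by x gives a fractional colouring of value ℓ.
-- Conversely, pad a fractional colouring y with the empty set to total weight exactly ℓ, and spread
-- the weight of each class I over the product distribution that, in the bundle of e_i = {u, w},
-- picks a_{iu} if u ∈ I, else a_{iw} if w ∈ I, and else one of the other ℓ - 2 arcs uniformly. The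
-- arc loads are Σ_{I ∋ u} y_I = 1, at most Σ_{I ∋ w} y_I = 1, and 1/(ℓ - 2) times the weight ℓ - 2
-- of the classes missing u and w; and only classes containing v contribute to λ(x, {a_{iv}, a_{jv}}).

module Submission where

open import Defs
open import Data.Nat using (ℕ; _≤_)
open import Data.Nat using (suc; zero; s≤s)
open import Data.Fin using (Fin)
open import Data.Product using (Σ; _×_; proj₁; proj₂)
open import Data.List using (List)
open import Data.Rational using (ℚ; 1ℚ) renaming (_≤_ to _≤ℚ_)
open import Relation.Binary.PropositionalEquality using (_≡_; _≢_)
open import Function.Bundles using (_⇔_)

import Data.Nat as ℕ
import Data.Nat.Properties as ℕ
open import Data.Bool using (Bool; true; false; _∧_; _∨_; not)
import Data.Bool.Properties as B
open import Data.Empty using (⊥-elim)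
open import Data.Unit using (tt)
open import Data.Product using (_,_; ∃)
open import Data.Sum using (_⊎_; inj₁; inj₂)
import Data.Fin as F
open import Data.Fin.Properties using (any?)
open import Data.Fin.Subset using (Subset; _∈_; ⊤) renaming (⊥ to ∅)
open import Data.Fin.Subset.Properties using (_∈?_; nonempty?)
open import Data.List using ([]; _∷_; _++_; map; concatMap; filter; allFin)
open import Data.List.Properties using (map-tabulate)
open import Data.Vec using (Vec; []; _∷_; lookup; tabulate)
import Data.Vec.Properties as V
import Data.Integer as ℤ using (+_; _+_; _*_; 1ℤ)
import Data.Integer.Properties as ℤ
open import Data.Rational using (0ℚ; _+_; _*_; _-_; -_; 1/_; Positive; nonNegative; toℚᵘ)
open import Data.Rational.Properties
open import Data.Rational.Solver using (module +-*-Solver)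
open +-*-Solver using (solve; _:+_; _:-_; :-_; _:=_)
open import Data.Rational.Unnormalised using (mkℚᵘ)
import Data.Rational.Unnormalised as ℚᵘ using (_+_; *≡*)
import Data.Rational.Unnormalised.Properties as ℚᵘ
open import Algebra.Bundles using (CommutativeMonoid)
open import Algebra.Properties.Group +-0-group using (∙-cancelʳ; x∙y⁻¹≈ε⇒x≈y)
open import Algebra.Properties.CommutativeSemigroup
  (CommutativeMonoid.commutativeSemigroup +-0-commutativeMonoid)
  using () renaming (interchange to +-interchange)
open import Function using (id; _∘_)
open import Function.Bundles using (mk⇔)
open import Level using (Level)
open import Relation.Binary.Definitions using (DecidableEquality)
open import Relation.Binary.PropositionalEquality using (refl; sym; trans; cong; cong₂; module ≡-Reasoning)
open import Relation.Nullary using (¬_; Dec; does; yes; no; ¬?)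
open import Relation.Nullary.Decidable using (dec-true; dec-false; _×-dec_; _⊎-dec_)
open import Relation.Unary using (Pred; Decidable)

∑ : {X : Set} → List X → (X → ℚ) → ℚ
∑ xs f = sumℚ (map f xs)

infix 5 ∑
syntax ∑ xs (λ x → f) = ∑[ x ∈ xs ] f

infixr 8 𝟙[_]_

𝟙[_]_ : Bool → ℚ → ℚ
𝟙[ true  ] q = q
𝟙[ false ] q = 0ℚ

private
  variable
    X Y : Set

𝟙-∧ : ∀ a b q → 𝟙[ a ∧ b ] q ≡ 𝟙[ a ] 𝟙[ b ] q
𝟙-∧ true  b q = refl
𝟙-∧ false b q = refl

𝟙-comm : ∀ a b q → 𝟙[ a ] 𝟙[ b ] q ≡ 𝟙[ b ] 𝟙[ a ] q
𝟙-comm true  b q = refl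
𝟙-comm false true  q = refl
𝟙-comm false false q = refl

𝟙-distrib-+ : ∀ b p q → 𝟙[ b ] (p + q) ≡ 𝟙[ b ] p + 𝟙[ b ] q
𝟙-distrib-+ true  p q = refl
𝟙-distrib-+ false p q = sym (+-identityʳ 0ℚ)

𝟙-*ˡ : ∀ b c q → 𝟙[ b ] (c * q) ≡ c * 𝟙[ b ] q
𝟙-*ˡ true  c q = refl
𝟙-*ˡ false c q = sym (*-zeroʳ c)

𝟙-as-* : ∀ b q → 𝟙[ b ] q ≡ q * 𝟙[ b ] 1ℚ
𝟙-as-* true  q = sym (*-identityʳ q)
𝟙-as-* false q = sym (*-zeroʳ q)

𝟙-nonNeg : ∀ b {q} → 0ℚ ≤ℚ q → 0ℚ ≤ℚ 𝟙[ b ] q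
𝟙-nonNeg true  0≤q = 0≤q
𝟙-nonNeg false 0≤q = ≤-refl

𝟙-≤ : ∀ b {q} → 0ℚ ≤ℚ q → 𝟙[ b ] q ≤ℚ q
𝟙-≤ true  0≤q = ≤-refl
𝟙-≤ false 0≤q = 0≤q

𝟙-∧-≤ : ∀ a b {q} → 0ℚ ≤ℚ q → 𝟙[ a ∧ b ] q ≤ℚ 𝟙[ b ] q
𝟙-∧-≤ true  b _   = ≤-refl
𝟙-∧-≤ false b 0≤q = 𝟙-nonNeg b 0≤q

𝟙-∨-≤ : ∀ a b {q} → 0ℚ ≤ℚ q → 𝟙[ a ∨ b ] q ≤ℚ 𝟙[ a ] q + 𝟙[ b ] q
𝟙-∨-≤ true  true  {q} 0≤q = ≤-trans (≤-reflexive (sym (+-identityʳ q))) (+-monoʳ-≤ q 0≤q)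
𝟙-∨-≤ true  false {q} _   = ≤-reflexive (sym (+-identityʳ q))
𝟙-∨-≤ false true  {q} _   = ≤-reflexive (sym (+-identityˡ q))
𝟙-∨-≤ false false     _   = ≤-reflexive (sym (+-identityˡ 0ℚ))

*-𝟙-swap : ∀ b p q → p * 𝟙[ b ] q ≡ q * 𝟙[ b ] p
*-𝟙-swap true  p q = *-comm p q
*-𝟙-swap false p q = trans (*-zeroʳ p) (sym (*-zeroʳ q))

𝟙-∧-not : ∀ α μ q → (α ≡ true → μ ≡ true → q ≡ 0ℚ) → 𝟙[ α ∧ not μ ] q ≡ 𝟙[ α ] q
𝟙-∧-not true  true  q α∧μ⇒q≡0 = sym (α∧μ⇒q≡0 refl refl)
𝟙-∧-not true  false q _       = refl
𝟙-∧-not false μ     q _       = refl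

𝟙-partition : ∀ a b q → 𝟙[ a ∧ b ] q ≡ 0ℚ → 𝟙[ not a ∧ not b ] q + 𝟙[ a ] q + 𝟙[ b ] q ≡ q
𝟙-partition true  true  q q≡0 rewrite q≡0 = refl
𝟙-partition true  false q _   = trans (+-identityʳ _) (+-identityˡ q)
𝟙-partition false true  q _   = +-identityˡ q
𝟙-partition false false q _   = trans (+-identityʳ _) (+-identityʳ q)

∑-cong : (xs : List X) {f g : X → ℚ} → (∀ x → f x ≡ g x) → ∑ xs f ≡ ∑ xs g
∑-cong []       f≡g = refl
∑-cong (x ∷ xs) f≡g = cong₂ _+_ (f≡g x) (∑-cong xs f≡g)

∑-zero : (xs : List X) → ∑[ x ∈ xs ] 0ℚ ≡ 0ℚ
∑-zero []       = refl
∑-zero (x ∷ xs) = trans (+-identityˡ _) (∑-zero xs)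

∑-distrib-+ : (xs : List X) (f g : X → ℚ) → ∑[ x ∈ xs ] (f x + g x) ≡ ∑ xs f + ∑ xs g
∑-distrib-+ []       f g = refl
∑-distrib-+ (x ∷ xs) f g =
  trans (cong ((f x + g x) +_) (∑-distrib-+ xs f g)) (+-interchange (f x) (g x) _ _)

∑-*ˡ : (xs : List X) (c : ℚ) (f : X → ℚ) → ∑[ x ∈ xs ] (c * f x) ≡ c * ∑ xs f
∑-*ˡ []       c f = sym (*-zeroʳ c)
∑-*ˡ (x ∷ xs) c f = trans (cong (c * f x +_) (∑-*ˡ xs c f)) (sym (*-distribˡ-+ c (f x) _))

∑-*ʳ : (xs : List X) (c : ℚ) (f : X → ℚ) → ∑[ x ∈ xs ] (f x * c) ≡ ∑ xs f * c
∑-*ʳ xs c f = trans (∑-cong xs (λ x → *-comm (f x) c)) (trans (∑-*ˡ xs c f) (*-comm c _))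

∑-mono-≤ : (xs : List X) {f g : X → ℚ} → (∀ x → f x ≤ℚ g x) → ∑ xs f ≤ℚ ∑ xs g
∑-mono-≤ []       f≤g = ≤-refl
∑-mono-≤ (x ∷ xs) f≤g = +-mono-≤ (f≤g x) (∑-mono-≤ xs f≤g)

∑-nonNeg : (xs : List X) {f : X → ℚ} → (∀ x → 0ℚ ≤ℚ f x) → 0ℚ ≤ℚ ∑ xs f
∑-nonNeg xs f≥0 = ≤-trans (≤-reflexive (sym (∑-zero xs))) (∑-mono-≤ xs f≥0)

∑-++ : (xs ys : List X) (f : X → ℚ) → ∑ (xs ++ ys) f ≡ ∑ xs f + ∑ ys f
∑-++ []       ys f = sym (+-identityˡ _)
∑-++ (x ∷ xs) ys f = trans (cong (f x +_) (∑-++ xs ys f)) (sym (+-assoc (f x) _ _))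

∑-concatMap : (xs : List X) (h : X → List Y) (f : Y → ℚ) →
              ∑ (concatMap h xs) f ≡ ∑[ x ∈ xs ] ∑ (h x) f
∑-concatMap []       h f = refl
∑-concatMap (x ∷ xs) h f = trans (∑-++ (h x) _ f) (cong (∑ (h x) f +_) (∑-concatMap xs h f))

∑-map : (xs : List X) (h : X → Y) (f : Y → ℚ) → ∑ (map h xs) f ≡ ∑[ x ∈ xs ] f (h x)
∑-map []       h f = refl
∑-map (x ∷ xs) h f = cong (f (h x) +_) (∑-map xs h f)

∑-comm : (xs : List X) (ys : List Y) (f : X → Y → ℚ) →
         ∑[ x ∈ xs ] ∑[ y ∈ ys ] f x y ≡ ∑[ y ∈ ys ] ∑[ x ∈ xs ] f x y
∑-comm []       ys f = sym (∑-zero ys)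
∑-comm (x ∷ xs) ys f =
  trans (cong (∑ ys (f x) +_) (∑-comm xs ys f)) (sym (∑-distrib-+ ys (f x) _))

∑-filter : {p : Level} {P : Pred X p} (P? : Decidable P) (xs : List X) (f : X → ℚ) →
           ∑ (filter P? xs) f ≡ ∑[ x ∈ xs ] 𝟙[ does (P? x) ] f x
∑-filter P? []       f = refl
∑-filter P? (x ∷ xs) f with does (P? x)
... | true  = cong (f x +_) (∑-filter P? xs f)
... | false = trans (∑-filter P? xs f) (sym (+-identityˡ _))

𝟙-∑ : (b : Bool) (xs : List X) (f : X → ℚ) → 𝟙[ b ] ∑ xs f ≡ ∑[ x ∈ xs ] 𝟙[ b ] f x
𝟙-∑ true  xs f = refl
𝟙-∑ false xs f = sym (∑-zero xs)

∑-partition : (xs : List X) (A B : X → Bool) (f : X → ℚ) → (∀ x → 𝟙[ A x ∧ B x ] f x ≡ 0ℚ) →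
  (∑[ x ∈ xs ] 𝟙[ not (A x) ∧ not (B x) ] f x) + (∑[ x ∈ xs ] 𝟙[ A x ] f x) + (∑[ x ∈ xs ] 𝟙[ B x ] f x)
    ≡ ∑ xs f
∑-partition xs A B f disjoint =
  trans (cong (_+ _) (sym (∑-distrib-+ xs _ _)))
  (trans (sym (∑-distrib-+ xs _ _)) (∑-cong xs λ x → 𝟙-partition (A x) (B x) (f x) (disjoint x)))

∑-allFin-suc : ∀ n (g : Fin (suc n) → ℚ) →
               ∑ (allFin (suc n)) g ≡ g F.zero + (∑[ k ∈ allFin n ] g (F.suc k))
∑-allFin-suc n g =
  cong (λ ks → g F.zero + sumℚ ks) (trans (map-tabulate F.suc g) (sym (map-tabulate id (g ∘ F.suc))))

∑-allVecs-suc : (xs : List X) (m : ℕ) (f : Vec X (suc m) → ℚ) →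
                ∑ (allVecs xs (suc m)) f ≡ ∑[ x ∈ xs ] ∑[ v ∈ allVecs xs m ] f (x ∷ v)
∑-allVecs-suc xs m f =
  trans (∑-concatMap xs _ f) (∑-cong xs (λ x → ∑-map (allVecs xs m) (x ∷_) f))

does-≟-comm : (_≟_ : DecidableEquality X) (x y : X) → does (x ≟ y) ≡ does (y ≟ x)
does-≟-comm _≟_ x y with x ≟ y | y ≟ x
... | yes _   | yes _   = refl
... | no  _   | no  _   = refl
... | yes x≡y | no  y≢x = ⊥-elim (y≢x (sym x≡y))
... | no  x≢y | yes y≡x = ⊥-elim (x≢y (sym y≡x))

does⇒ : {A : Set} (a? : Dec A) → does a? ≡ true → A
does⇒ (yes a) _ = a

-- The sifting property of the Kronecker delta: it says that xs lists every element exactly once.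
record IsEnumeration (_≟_ : DecidableEquality X) (xs : List X) : Set where
  constructor sifting
  field sift : ∀ x₀ (f : X → ℚ) → ∑[ x ∈ xs ] 𝟙[ does (x ≟ x₀) ] f x ≡ f x₀

open IsEnumeration

allFin-isEnumeration : ∀ n → IsEnumeration F._≟_ (allFin n)
allFin-isEnumeration zero    = sifting λ ()
allFin-isEnumeration (suc n) = sifting λ k₀ f →
  trans (∑-allFin-suc n (λ k → 𝟙[ does (k F.≟ k₀) ] f k)) (peel f k₀)
  where
  peel : ∀ f k₀ → 𝟙[ does (F.zero F.≟ k₀) ] f F.zero
                + (∑[ k ∈ allFin n ] 𝟙[ does (F.suc k F.≟ k₀) ] f (F.suc k))
                ≡ f k₀
  peel f F.zero      = trans (cong (f F.zero +_) (∑-zero (allFin n))) (+-identityʳ _)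
  peel f (F.suc k₀)  = trans (+-identityˡ _) (sift (allFin-isEnumeration n) k₀ (f ∘ F.suc))

bools-isEnumeration : IsEnumeration B._≟_ (true ∷ false ∷ [])
bools-isEnumeration = sifting λ where
  true  f → trans (cong (f true +_) (+-identityʳ 0ℚ)) (+-identityʳ _)
  false f → trans (+-identityˡ _) (+-identityʳ _)

allVecs-isEnumeration : {_≟_ : DecidableEquality X} {xs : List X} → IsEnumeration _≟_ xs →
                        ∀ m → IsEnumeration (V.≡-dec _≟_) (allVecs xs m)
allVecs-isEnumeration {_≟_ = _≟_} {xs} enum m = sifting (siftVecs m)
  where
  open ≡-Reasoning
  siftVecs : ∀ m v₀ (f : Vec _ m → ℚ) → ∑[ v ∈ allVecs xs m ] 𝟙[ does (V.≡-dec _≟_ v v₀) ] f v ≡ f v₀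
  siftVecs zero    []         f = +-identityʳ _
  siftVecs (suc m) (x₀ ∷ v₀) f = begin
    ∑[ v ∈ allVecs xs (suc m) ] 𝟙[ does (V.≡-dec _≟_ v (x₀ ∷ v₀)) ] f v
      ≡⟨ ∑-allVecs-suc xs m _ ⟩
    ∑[ x ∈ xs ] ∑[ v ∈ allVecs xs m ] 𝟙[ does (x ≟ x₀) ∧ does (V.≡-dec _≟_ v v₀) ] f (x ∷ v)
      ≡⟨ ∑-cong xs (λ x → trans (∑-cong (allVecs xs m) (λ v → 𝟙-∧ (does (x ≟ x₀)) _ _))
                                (sym (𝟙-∑ (does (x ≟ x₀)) (allVecs xs m) _))) ⟩
    ∑[ x ∈ xs ] 𝟙[ does (x ≟ x₀) ] (∑[ v ∈ allVecs xs m ] 𝟙[ does (V.≡-dec _≟_ v v₀) ] f (x ∷ v))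
      ≡⟨ ∑-cong xs (λ x → cong 𝟙[ does (x ≟ x₀) ]_ (siftVecs m v₀ (f ∘ (x ∷_)))) ⟩
    ∑[ x ∈ xs ] 𝟙[ does (x ≟ x₀) ] f (x ∷ v₀)
      ≡⟨ sift enum x₀ (λ x → f (x ∷ v₀)) ⟩
    f (x₀ ∷ v₀) ∎

module _ {_≟_ : DecidableEquality X} {xs : List X} (enum : IsEnumeration _≟_ xs)
         {f : X → ℚ} (f≥0 : ∀ x → 0ℚ ≤ℚ f x) where

  term≤∑ : ∀ x₀ → f x₀ ≤ℚ ∑ xs f
  term≤∑ x₀ = ≤-trans (≤-reflexive (sym (sift enum x₀ f))) (∑-mono-≤ xs 𝟙[x≡x₀]f≤f)
    where
    𝟙[x≡x₀]f≤f : ∀ x → 𝟙[ does (x ≟ x₀) ] f x ≤ℚ f x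
    𝟙[x≡x₀]f≤f x with does (x ≟ x₀)
    ... | true  = ≤-refl
    ... | false = f≥0 x

  ∑≤0⇒≡0 : ∑ xs f ≤ℚ 0ℚ → ∀ x₀ → f x₀ ≡ 0ℚ
  ∑≤0⇒≡0 ∑≤0 x₀ = ≤-antisym (≤-trans (term≤∑ x₀) ∑≤0) (f≥0 x₀)

0≤1 : 0ℚ ≤ℚ 1ℚ
0≤1 = nonNegative⁻¹ 1ℚ

*-nonNeg : ∀ {p q} → 0ℚ ≤ℚ p → 0ℚ ≤ℚ q → 0ℚ ≤ℚ p * q
*-nonNeg {p} {q} 0≤p 0≤q =
  ≤-trans (≤-reflexive (sym (*-zeroˡ q))) (*-monoʳ-≤-nonNeg q {{nonNegative 0≤q}} 0≤p)

≡0⇒*-const : ∀ {a} → a ≡ 0ℚ → ∀ p q → a * p ≡ a * q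
≡0⇒*-const refl p q = trans (*-zeroˡ p) (sym (*-zeroˡ q))

p≤q⇒0≤q-p : ∀ {p q} → p ≤ℚ q → 0ℚ ≤ℚ q - p
p≤q⇒0≤q-p {p} {q} p≤q = ≤-trans (≤-reflexive (sym (+-inverseʳ p))) (+-monoˡ-≤ (- p) p≤q)

+-cancelˡ-≤ : ∀ r {p q} → r + p ≤ℚ r + q → p ≤ℚ q
+-cancelˡ-≤ r {p} {q} r+p≤r+q =
  ≤-trans (≤-reflexive (p≡-r+[r+p] p)) (≤-trans (+-monoʳ-≤ (- r) r+p≤r+q) (≤-reflexive (sym (p≡-r+[r+p] q))))
  where
  p≡-r+[r+p] : ∀ p → p ≡ - r + (r + p)
  p≡-r+[r+p] p = solve 2 (λ p r → p := :- r :+ (r :+ p)) refl p r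

ℕtoℚ-nonNeg : ∀ k → 0ℚ ≤ℚ ℕtoℚ k
ℕtoℚ-nonNeg k = nonNegative⁻¹ (ℕtoℚ k) {{normalize-nonNeg k 1}}

ℕtoℚ-suc : ∀ k → ℕtoℚ (suc k) ≡ 1ℚ + ℕtoℚ k
ℕtoℚ-suc k = toℚᵘ-injective (ℚᵘ.≃-sym (begin
  toℚᵘ (1ℚ + ℕtoℚ k)             ≈⟨ toℚᵘ-homo-+ 1ℚ (ℕtoℚ k) ⟩
  toℚᵘ 1ℚ ℚᵘ.+ toℚᵘ (ℕtoℚ k)      ≈⟨ ℚᵘ.+-congʳ (toℚᵘ 1ℚ) (toℚᵘ-fromℚᵘ (mkℚᵘ (ℤ.+ k) 0)) ⟩
  mkℚᵘ ℤ.1ℤ 0 ℚᵘ.+ mkℚᵘ (ℤ.+ k) 0  ≈⟨ ℚᵘ.*≡* 1+k-numerator ⟩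
  mkℚᵘ (ℤ.+ suc k) 0               ≈⟨ toℚᵘ-fromℚᵘ (mkℚᵘ (ℤ.+ suc k) 0) ⟨
  toℚᵘ (ℕtoℚ (suc k))            ∎))
  where
  open ℚᵘ.≃-Reasoning
  1+k-numerator : (ℤ.1ℤ ℤ.* ℤ.1ℤ ℤ.+ ℤ.+ k ℤ.* ℤ.1ℤ) ℤ.* ℤ.1ℤ ≡ ℤ.+ suc k ℤ.* (ℤ.1ℤ ℤ.* ℤ.1ℤ)
  1+k-numerator =
    trans (ℤ.*-identityʳ _) (trans (cong (ℤ._+_ ℤ.1ℤ) (ℤ.*-identityʳ (ℤ.+ k))) (sym (ℤ.*-identityʳ _)))

∑-allFin-1 : ∀ n → ∑[ k ∈ allFin n ] 1ℚ ≡ ℕtoℚ n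
∑-allFin-1 zero    = refl
∑-allFin-1 (suc n) =
  trans (∑-allFin-suc n (λ _ → 1ℚ)) (trans (cong (1ℚ +_) (∑-allFin-1 n)) (sym (ℕtoℚ-suc n)))

≤1∧∑≡n⇒≡1 : ∀ n (f : Fin n → ℚ) → (∀ k → f k ≤ℚ 1ℚ) → ∑ (allFin n) f ≡ ℕtoℚ n → ∀ k → f k ≡ 1ℚ
≤1∧∑≡n⇒≡1 n f f≤1 ∑f≡n k = sym (x∙y⁻¹≈ε⇒x≈y 1ℚ (f k) (1-f≡0 k))
  where
  1-f≥0 : ∀ k → 0ℚ ≤ℚ 1ℚ - f k
  1-f≥0 k = p≤q⇒0≤q-p (f≤1 k)
  ∑[1-f]+∑f≡0+∑f : (∑[ k ∈ allFin n ] (1ℚ - f k)) + ∑ (allFin n) f ≡ 0ℚ + ∑ (allFin n) f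
  ∑[1-f]+∑f≡0+∑f = begin
    (∑[ k ∈ allFin n ] (1ℚ - f k)) + ∑ (allFin n) f  ≡⟨ ∑-distrib-+ (allFin n) _ f ⟨
    ∑[ k ∈ allFin n ] (1ℚ - f k + f k)              ≡⟨ ∑-cong (allFin n) (λ k → solve 2 (λ a b → (a :- b) :+ b := a) refl 1ℚ (f k)) ⟩
    ∑[ k ∈ allFin n ] 1ℚ                           ≡⟨ trans (∑-allFin-1 n) (sym ∑f≡n) ⟩
    ∑ (allFin n) f                                 ≡⟨ +-identityˡ _ ⟨
    0ℚ + ∑ (allFin n) f                            ∎
    where open ≡-Reasoning
  1-f≡0 : ∀ k → 1ℚ - f k ≡ 0ℚ
  1-f≡0 = ∑≤0⇒≡0 (allFin-isEnumeration n) 1-f≥0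
            (≤-reflexive (∙-cancelʳ (∑ (allFin n) f) _ _ ∑[1-f]+∑f≡0+∑f))

ℕtoℚ-suc-pos : ∀ k → Positive (ℕtoℚ (suc k))
ℕtoℚ-suc-pos k = normalize-pos (suc k) 1

-- 1/k, with the junk value 0 at k = 0.
inv : ℕ → ℚ
inv zero    = 0ℚ
inv (suc k) = 1/ ℕtoℚ (suc k)
  where instance _ = pos⇒nonZero (ℕtoℚ (suc k)) {{ℕtoℚ-suc-pos k}}

inv-nonNeg : ∀ k → 0ℚ ≤ℚ inv k
inv-nonNeg zero    = ≤-refl
inv-nonNeg (suc k) =
  nonNegative⁻¹ (inv (suc k)) {{pos⇒nonNeg (inv (suc k)) {{1/pos⇒pos (ℕtoℚ (suc k)) {{ℕtoℚ-suc-pos k}}}}}}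

inv-*-suc : ∀ k → inv (suc k) * ℕtoℚ (suc k) ≡ 1ℚ
inv-*-suc k = *-inverseˡ (ℕtoℚ (suc k)) {{pos⇒nonZero (ℕtoℚ (suc k)) {{ℕtoℚ-suc-pos k}}}}

inv-*≤1 : ∀ k → inv k * ℕtoℚ k ≤ℚ 1ℚ
inv-*≤1 zero    = 0≤1
inv-*≤1 (suc k) = ≤-reflexive (inv-*-suc k)

productWeight : ∀ {m} → (Fin m → X → ℚ) → Vec X m → ℚ
productWeight q []      = 1ℚ
productWeight q (x ∷ v) = q F.zero x * productWeight (q ∘ F.suc) v

productWeight-nonNeg : ∀ {m} (q : Fin m → X → ℚ) → (∀ i x → 0ℚ ≤ℚ q i x) → ∀ v → 0ℚ ≤ℚ productWeight q v
productWeight-nonNeg q q≥0 []      = 0≤1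
productWeight-nonNeg q q≥0 (x ∷ v) =
  *-nonNeg (q≥0 F.zero x) (productWeight-nonNeg (q ∘ F.suc) (q≥0 ∘ F.suc) v)

module _ (xs : List X) where

  ∑-productWeight : ∀ m (q : Fin m → X → ℚ) → (∀ i → ∑ xs (q i) ≡ 1ℚ) →
                    ∑ (allVecs xs m) (productWeight q) ≡ 1ℚ
  ∑-productWeight zero    q ∑q≡1 = +-identityʳ 1ℚ
  ∑-productWeight (suc m) q ∑q≡1 = begin
    ∑ (allVecs xs (suc m)) (productWeight q)                             ≡⟨ ∑-allVecs-suc xs m _ ⟩
    ∑[ x ∈ xs ] ∑[ v ∈ allVecs xs m ] (q F.zero x * productWeight (q ∘ F.suc) v)
      ≡⟨ ∑-cong xs (λ x → ∑-*ˡ (allVecs xs m) (q F.zero x) _) ⟩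
    ∑[ x ∈ xs ] (q F.zero x * ∑ (allVecs xs m) (productWeight (q ∘ F.suc)))
      ≡⟨ ∑-cong xs (λ x → cong (q F.zero x *_) (∑-productWeight m (q ∘ F.suc) (∑q≡1 ∘ F.suc))) ⟩
    ∑[ x ∈ xs ] (q F.zero x * 1ℚ)                                       ≡⟨ ∑-cong xs (λ x → *-identityʳ _) ⟩
    ∑ xs (q F.zero)                                                     ≡⟨ ∑q≡1 F.zero ⟩
    1ℚ                                                                  ∎
    where open ≡-Reasoning

  ∑-productWeight-marginal : {_≟_ : DecidableEquality X} → IsEnumeration _≟_ xs →
    ∀ m (q : Fin m → X → ℚ) → (∀ i → ∑ xs (q i) ≡ 1ℚ) →
    ∀ j x₀ → ∑[ v ∈ allVecs xs m ] 𝟙[ does (lookup v j ≟ x₀) ] productWeight q v ≡ q j x₀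
  ∑-productWeight-marginal {_≟_} enum (suc m) q ∑q≡1 F.zero x₀ = begin
    ∑[ v ∈ allVecs xs (suc m) ] 𝟙[ does (lookup v F.zero ≟ x₀) ] productWeight q v
      ≡⟨ ∑-allVecs-suc xs m _ ⟩
    ∑[ x ∈ xs ] ∑[ v ∈ allVecs xs m ] 𝟙[ does (x ≟ x₀) ] (q F.zero x * productWeight (q ∘ F.suc) v)
      ≡⟨ ∑-cong xs (λ x → sym (𝟙-∑ (does (x ≟ x₀)) (allVecs xs m) _)) ⟩
    ∑[ x ∈ xs ] 𝟙[ does (x ≟ x₀) ] (∑[ v ∈ allVecs xs m ] (q F.zero x * productWeight (q ∘ F.suc) v))
      ≡⟨ ∑-cong xs (λ x → cong 𝟙[ does (x ≟ x₀) ]_ (∑-*ˡ (allVecs xs m) (q F.zero x) _)) ⟩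
    ∑[ x ∈ xs ] 𝟙[ does (x ≟ x₀) ] (q F.zero x * ∑ (allVecs xs m) (productWeight (q ∘ F.suc)))
      ≡⟨ ∑-cong xs (λ x → cong (λ s → 𝟙[ does (x ≟ x₀) ] (q F.zero x * s))
                               (∑-productWeight m (q ∘ F.suc) (∑q≡1 ∘ F.suc))) ⟩
    ∑[ x ∈ xs ] 𝟙[ does (x ≟ x₀) ] (q F.zero x * 1ℚ)
      ≡⟨ ∑-cong xs (λ x → cong 𝟙[ does (x ≟ x₀) ]_ (*-identityʳ _)) ⟩
    ∑[ x ∈ xs ] 𝟙[ does (x ≟ x₀) ] q F.zero x
      ≡⟨ sift enum x₀ (q F.zero) ⟩
    q F.zero x₀ ∎
    where open ≡-Reasoning
  ∑-productWeight-marginal {_≟_} enum (suc m) q ∑q≡1 (F.suc j) x₀ = begin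
    ∑[ v ∈ allVecs xs (suc m) ] 𝟙[ does (lookup v (F.suc j) ≟ x₀) ] productWeight q v
      ≡⟨ ∑-allVecs-suc xs m _ ⟩
    ∑[ x ∈ xs ] ∑[ v ∈ allVecs xs m ] 𝟙[ does (lookup v j ≟ x₀) ] (q F.zero x * productWeight (q ∘ F.suc) v)
      ≡⟨ ∑-cong xs (λ x → ∑-cong (allVecs xs m) (λ v → 𝟙-*ˡ (does (lookup v j ≟ x₀)) (q F.zero x) _)) ⟩
    ∑[ x ∈ xs ] ∑[ v ∈ allVecs xs m ] (q F.zero x * 𝟙[ does (lookup v j ≟ x₀) ] productWeight (q ∘ F.suc) v)
      ≡⟨ ∑-cong xs (λ x → ∑-*ˡ (allVecs xs m) (q F.zero x) _) ⟩
    ∑[ x ∈ xs ] (q F.zero x * (∑[ v ∈ allVecs xs m ] 𝟙[ does (lookup v j ≟ x₀) ] productWeight (q ∘ F.suc) v))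
      ≡⟨ ∑-cong xs (λ x → cong (q F.zero x *_)
                               (∑-productWeight-marginal enum m (q ∘ F.suc) (∑q≡1 ∘ F.suc) j x₀)) ⟩
    ∑[ x ∈ xs ] (q F.zero x * q (F.suc j) x₀)
      ≡⟨ ∑-*ʳ xs _ (q F.zero) ⟩
    ∑ xs (q F.zero) * q (F.suc j) x₀
      ≡⟨ cong (_* q (F.suc j) x₀) (∑q≡1 F.zero) ⟩
    1ℚ * q (F.suc j) x₀
      ≡⟨ *-identityˡ _ ⟩
    q (F.suc j) x₀ ∎
    where open ≡-Reasoning

does-∈? : ∀ {n} (v : Fin n) (I : Subset n) → does (v ∈? I) ≡ lookup I v
does-∈? F.zero    (true  ∷ I) = refl
does-∈? F.zero    (false ∷ I) = refl
does-∈? (F.suc v) (_ ∷ I)     = does-∈? v I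

_≟ₛ_ : ∀ {n} → DecidableEquality (Subset n)
_≟ₛ_ = V.≡-dec B._≟_

allSubsets-isEnumeration : ∀ n → IsEnumeration _≟ₛ_ (allSubsets n)
allSubsets-isEnumeration = allVecs-isEnumeration bools-isEnumeration

isNonempty : ∀ {n} → Subset n → Bool
isNonempty I = does (nonempty? I)

fracChromLe-fromFamily : ∀ {n m} (e : Fin m → Fin n × Fin n) (ℓ : ℕ)
  (xs : List X) (z : X → ℚ) (S : X → Subset n) →
  (∀ x → 0ℚ ≤ℚ z x) → (∀ x → Independent e (S x)) →
  (∀ v → ∑[ x ∈ xs ] 𝟙[ lookup (S x) v ] z x ≡ 1ℚ) → ∑ xs z ≤ℚ ℕtoℚ ℓ → FracChromLe e ℓ
fracChromLe-fromFamily {n = n} e ℓ xs z S z≥0 S-indep S-cover ∑z≤ℓ = y , y≥0 , y-IG , y-cover , y-total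
  where
  Is = allSubsets n
  enum = allSubsets-isEnumeration n

  y : Subset n → ℚ
  y I = ∑[ x ∈ xs ] 𝟙[ does (I ≟ₛ S x) ] 𝟙[ isNonempty I ] z x

  ∑-y : ∀ (g : Subset n → Bool) →
        ∑[ I ∈ Is ] 𝟙[ g I ] y I ≡ ∑[ x ∈ xs ] 𝟙[ g (S x) ] 𝟙[ isNonempty (S x) ] z x
  ∑-y g = begin
    ∑[ I ∈ Is ] 𝟙[ g I ] y I
      ≡⟨ ∑-cong Is (λ I → 𝟙-∑ (g I) xs _) ⟩
    ∑[ I ∈ Is ] ∑[ x ∈ xs ] 𝟙[ g I ] 𝟙[ does (I ≟ₛ S x) ] 𝟙[ isNonempty I ] z x
      ≡⟨ ∑-comm Is xs _ ⟩
    ∑[ x ∈ xs ] ∑[ I ∈ Is ] 𝟙[ g I ] 𝟙[ does (I ≟ₛ S x) ] 𝟙[ isNonempty I ] z x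
      ≡⟨ ∑-cong xs (λ x → ∑-cong Is (λ I → 𝟙-comm (g I) (does (I ≟ₛ S x)) _)) ⟩
    ∑[ x ∈ xs ] ∑[ I ∈ Is ] 𝟙[ does (I ≟ₛ S x) ] 𝟙[ g I ] 𝟙[ isNonempty I ] z x
      ≡⟨ ∑-cong xs (λ x → sift enum (S x) (λ I → 𝟙[ g I ] 𝟙[ isNonempty I ] z x)) ⟩
    ∑[ x ∈ xs ] 𝟙[ g (S x) ] 𝟙[ isNonempty (S x) ] z x ∎
    where open ≡-Reasoning

  y≥0 : ∀ I → 0ℚ ≤ℚ y I
  y≥0 I = ∑-nonNeg xs (λ x → 𝟙-nonNeg (does (I ≟ₛ S x)) (𝟙-nonNeg (isNonempty I) (z≥0 x)))

  y-IG : ∀ I → ¬ InIG e I → y I ≡ 0ℚ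
  y-IG I I∉IG = trans (∑-cong xs vanish) (∑-zero xs)
    where
    vanish : ∀ x → 𝟙[ does (I ≟ₛ S x) ] 𝟙[ isNonempty I ] z x ≡ 0ℚ
    vanish x with I ≟ₛ S x | isNonempty I in ne
    ... | no  _    | _     = refl
    ... | yes _    | false = refl
    ... | yes refl | true  = ⊥-elim (I∉IG (does⇒ (nonempty? I) ne , S-indep x))

  y-cover : ∀ v → sumℚ (map y (filter (v ∈?_) Is)) ≡ 1ℚ
  y-cover v = begin
    sumℚ (map y (filter (v ∈?_) Is))
      ≡⟨ ∑-filter (v ∈?_) Is y ⟩
    ∑[ I ∈ Is ] 𝟙[ does (v ∈? I) ] y I
      ≡⟨ ∑-cong Is (λ I → cong (λ b → 𝟙[ b ] y I) (does-∈? v I)) ⟩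
    ∑[ I ∈ Is ] 𝟙[ lookup I v ] y I
      ≡⟨ ∑-y (λ I → lookup I v) ⟩
    ∑[ x ∈ xs ] 𝟙[ lookup (S x) v ] 𝟙[ isNonempty (S x) ] z x
      ≡⟨ ∑-cong xs (λ x → member⇒nonempty (S x) (z x)) ⟩
    ∑[ x ∈ xs ] 𝟙[ lookup (S x) v ] z x
      ≡⟨ S-cover v ⟩
    1ℚ ∎
    where
    open ≡-Reasoning
    member⇒nonempty : ∀ J q → 𝟙[ lookup J v ] 𝟙[ isNonempty J ] q ≡ 𝟙[ lookup J v ] q
    member⇒nonempty J q with lookup J v in v∈J
    ... | false = refl
    ... | true  rewrite dec-true (nonempty? J) (v , V.lookup⇒[]= v J v∈J) = refl

  y-total : sumℚ (map y Is) ≤ℚ ℕtoℚ ℓ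
  y-total = begin
    ∑[ I ∈ Is ] y I                                ≡⟨ ∑-y (λ _ → true) ⟩
    ∑[ x ∈ xs ] 𝟙[ isNonempty (S x) ] z x          ≤⟨ ∑-mono-≤ xs (λ x → 𝟙-≤ (isNonempty (S x)) (z≥0 x)) ⟩
    ∑ xs z                                         ≤⟨ ∑z≤ℓ ⟩
    ℕtoℚ ℓ                                         ∎
    where open ≤-Reasoning

edgeless⇒fracChromLe : ∀ n ℓ (e : Fin 0 → Fin n × Fin n) → FracChromLe e (suc ℓ)
edgeless⇒fracChromLe n ℓ e =
  fracChromLe-fromFamily e (suc ℓ) (tt ∷ []) (λ _ → 1ℚ) (λ _ → ⊤) (λ _ → 0≤1) (λ _ _ _ _ _ ()) cover total
  where
  cover : ∀ v → ∑[ _ ∈ tt ∷ [] ] 𝟙[ lookup ⊤ v ] 1ℚ ≡ 1ℚ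
  cover v rewrite V.lookup-replicate v true = +-identityʳ 1ℚ
  total : 1ℚ + 0ℚ ≤ℚ ℕtoℚ (suc ℓ)
  total = ≤-trans (+-monoʳ-≤ 1ℚ (ℕtoℚ-nonNeg ℓ)) (≤-reflexive (sym (ℕtoℚ-suc ℓ)))

-- Unlike in FracChromLe, the empty set may carry weight, so that the total can be exactly ℓ.
record ExactColouring {n m : ℕ} (e : Fin m → Fin n × Fin n) (ℓ : ℕ) : Set where
  field
    weight        : Subset n → ℚ
    weight-nonNeg : ∀ I → 0ℚ ≤ℚ weight I
    weight-total  : ∑ (allSubsets n) weight ≡ ℕtoℚ ℓ
    weight-cover  : ∀ v → ∑[ I ∈ allSubsets n ] 𝟙[ lookup I v ] weight I ≡ 1ℚ
    weight-edge   : ∀ i I → lookup I (proj₁ (e i)) ≡ true → lookup I (proj₂ (e i)) ≡ true → weight I ≡ 0ℚ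

fracChromLe⇒exactColouring : ∀ {n m} {e : Fin m → Fin n × Fin n} {ℓ} → FracChromLe e ℓ → ExactColouring e ℓ
fracChromLe⇒exactColouring {n} {e = e} {ℓ} (y , y≥0 , y-IG , y-cover , y-total) = record
  { weight        = y′
  ; weight-nonNeg = λ I → +-mono-≤ (y≥0 I) (𝟙-nonNeg (does (I ≟ₛ ∅)) (p≤q⇒0≤q-p y-total))
  ; weight-total  = trans (∑-distrib-+ Is y _) (trans (cong (K +_) (sift enum ∅ (λ _ → slack)))
                      (solve 2 (λ k l → k :+ (l :- k) := l) refl K (ℕtoℚ ℓ)))
  ; weight-cover  = cover
  ; weight-edge   = edge
  }
  where
  Is = allSubsets n
  enum = allSubsets-isEnumeration n
  K = ∑ Is y
  slack = ℕtoℚ ℓ - K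

  y′ : Subset n → ℚ
  y′ I = y I + 𝟙[ does (I ≟ₛ ∅) ] slack

  cover : ∀ v → ∑[ I ∈ Is ] 𝟙[ lookup I v ] y′ I ≡ 1ℚ
  cover v = begin
    ∑[ I ∈ Is ] 𝟙[ lookup I v ] y′ I
      ≡⟨ ∑-cong Is (λ I → 𝟙-distrib-+ (lookup I v) (y I) _) ⟩
    ∑[ I ∈ Is ] (𝟙[ lookup I v ] y I + 𝟙[ lookup I v ] 𝟙[ does (I ≟ₛ ∅) ] slack)
      ≡⟨ ∑-distrib-+ Is _ _ ⟩
    (∑[ I ∈ Is ] 𝟙[ lookup I v ] y I) + (∑[ I ∈ Is ] 𝟙[ lookup I v ] 𝟙[ does (I ≟ₛ ∅) ] slack)
      ≡⟨ cong₂ _+_ y-cover′ (trans (∑-cong Is (λ I → 𝟙-comm (lookup I v) (does (I ≟ₛ ∅)) slack))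
                                   (sift enum ∅ (λ I → 𝟙[ lookup I v ] slack))) ⟩
    1ℚ + 𝟙[ lookup ∅ v ] slack
      ≡⟨ cong (λ b → 1ℚ + 𝟙[ b ] slack) (V.lookup-replicate v false) ⟩
    1ℚ + 0ℚ
      ≡⟨ +-identityʳ 1ℚ ⟩
    1ℚ ∎
    where
    open ≡-Reasoning
    y-cover′ : ∑[ I ∈ Is ] 𝟙[ lookup I v ] y I ≡ 1ℚ
    y-cover′ = trans (∑-cong Is (λ I → cong (λ b → 𝟙[ b ] y I) (sym (does-∈? v I))))
                     (trans (sym (∑-filter (v ∈?_) Is y)) (y-cover v))

  edge : ∀ i I → lookup I (proj₁ (e i)) ≡ true → lookup I (proj₂ (e i)) ≡ true → y′ I ≡ 0ℚ
  edge i I u∈I w∈I = trans (cong₂ _+_ (y-IG I ¬IG) (cong (λ b → 𝟙[ b ] slack) (dec-false (I ≟ₛ ∅) I≢∅)))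
                           (+-identityʳ 0ℚ)
    where
    ¬IG : ¬ InIG e I
    ¬IG (_ , independent) = independent _ _ (V.lookup⇒[]= _ I u∈I) (V.lookup⇒[]= _ I w∈I) (i , inj₁ (refl , refl))
    I≢∅ : I ≢ ∅
    I≢∅ refl = B.not-¬ (V.lookup-replicate (proj₁ (e i)) false) u∈I

allPaths-isEnumeration : ∀ m ℓ → IsEnumeration (V.≡-dec F._≟_) (allPaths m ℓ)
allPaths-isEnumeration m ℓ = allVecs-isEnumeration (allFin-isEnumeration ℓ) m

module _ {m ℓ : ℕ} (x : Path m ℓ → ℚ) where

  load : Arc m ℓ → ℚ
  load a = ∑[ P ∈ allPaths m ℓ ] 𝟙[ does (a ∈P? P) ] x P

  IsPathFlow⇒load≤1 : IsPathFlow x → ∀ a → load a ≤ℚ 1ℚ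
  IsPathFlow⇒load≤1 (_ , capacity) a =
    ≤-trans (≤-reflexive (sym (∑-filter (a ∈P?_) (allPaths m ℓ) x))) (capacity a)

  ∑-load-bundle : ∀ i → ∑[ k ∈ allFin ℓ ] load (i , k) ≡ flowValue x
  ∑-load-bundle i = begin
    ∑[ k ∈ allFin ℓ ] ∑[ P ∈ allPaths m ℓ ] 𝟙[ does (lookup P i F.≟ k) ] x P
      ≡⟨ ∑-comm (allFin ℓ) (allPaths m ℓ) _ ⟩
    ∑[ P ∈ allPaths m ℓ ] ∑[ k ∈ allFin ℓ ] 𝟙[ does (lookup P i F.≟ k) ] x P
      ≡⟨ ∑-cong (allPaths m ℓ) (λ P → ∑-cong (allFin ℓ) λ k →
           cong (λ b → 𝟙[ b ] x P) (does-≟-comm F._≟_ (lookup P i) k)) ⟩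
    ∑[ P ∈ allPaths m ℓ ] ∑[ k ∈ allFin ℓ ] 𝟙[ does (k F.≟ lookup P i) ] x P
      ≡⟨ ∑-cong (allPaths m ℓ) (λ P → sift (allFin-isEnumeration ℓ) (lookup P i) (λ _ → x P)) ⟩
    ∑[ P ∈ allPaths m ℓ ] x P ∎
    where open ≡-Reasoning

  -- Each bundle consists of ℓ arcs of capacity 1 that together carry the whole flow value ℓ.
  maxFlow⇒load≡1 : IsPathFlow x → flowValue x ≡ ℕtoℚ ℓ → ∀ a → load a ≡ 1ℚ
  maxFlow⇒load≡1 isFlow value (i , k) =
    ≤1∧∑≡n⇒≡1 ℓ (λ k → load (i , k)) (λ k → IsPathFlow⇒load≤1 isFlow (i , k))
           (trans (∑-load-bundle i) value) k

  lam-single : ∀ a → lam x (a ∷ []) ≡ load a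
  lam-single a = trans (∑-filter _ (allPaths m ℓ) x)
    (∑-cong (allPaths m ℓ) (λ P → cong (λ b → 𝟙[ b ] x P) (B.∨-identityʳ (does (a ∈P? P)))))

  -- λ(x, {a, b}) ≥ load b + (flow on the paths through a avoiding b).
  load≡1∧λ≤1⇒x≡0 : (∀ P → 0ℚ ≤ℚ x P) → ∀ a b → load b ≡ 1ℚ → lam x (a ∷ b ∷ []) ≤ℚ 1ℚ →
    ∀ P → a ∈P P → ¬ b ∈P P → x P ≡ 0ℚ
  load≡1∧λ≤1⇒x≡0 x≥0 a b load-b≡1 λ≤1 P a∈P b∉P =
    trans (sym (cong₂ (λ A B → 𝟙[ A ∧ not B ] x P) (dec-true (a ∈P? P) a∈P) (dec-false (b ∈P? P) b∉P)))
          (∑≤0⇒≡0 (allPaths-isEnumeration m ℓ) (λ Q → 𝟙-nonNeg (A Q ∧ not (B Q)) (x≥0 Q)) p≤0 P)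
    where
    A B : Path m ℓ → Bool
    A Q = does (a ∈P? Q)
    B Q = does (b ∈P? Q)
    split : ∀ α β q → 𝟙[ α ∨ (β ∨ false) ] q ≡ 𝟙[ β ] q + 𝟙[ α ∧ not β ] q
    split true  true  q = sym (+-identityʳ q)
    split true  false q = sym (+-identityˡ q)
    split false true  q = sym (+-identityʳ q)
    split false false q = sym (+-identityˡ 0ℚ)
    p = ∑[ Q ∈ allPaths m ℓ ] 𝟙[ A Q ∧ not (B Q) ] x Q
    1+p≤1+0 : 1ℚ + p ≤ℚ 1ℚ + 0ℚ
    1+p≤1+0 = begin
      1ℚ + p                                                      ≡⟨ cong (_+ p) load-b≡1 ⟨
      load b + p                                                  ≡⟨ ∑-distrib-+ (allPaths m ℓ) _ _ ⟨
      ∑[ Q ∈ allPaths m ℓ ] (𝟙[ B Q ] x Q + 𝟙[ A Q ∧ not (B Q) ] x Q) ≡⟨ ∑-cong (allPaths m ℓ) (λ Q → split (A Q) (B Q) (x Q)) ⟨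
      ∑[ Q ∈ allPaths m ℓ ] 𝟙[ A Q ∨ (B Q ∨ false) ] x Q            ≡⟨ ∑-filter _ (allPaths m ℓ) x ⟨
      lam x (a ∷ b ∷ [])                                          ≤⟨ λ≤1 ⟩
      1ℚ                                                          ≡⟨ +-identityʳ 1ℚ ⟨
      1ℚ + 0ℚ                                                     ∎
      where open ≤-Reasoning
    p≤0 : p ≤ℚ 0ℚ
    p≤0 = +-cancelˡ-≤ 1ℚ 1+p≤1+0

module _ {n m ℓ : ℕ} (e : Fin m → Fin n × Fin n) (c : Fin m → Fin ℓ × Fin ℓ) where

  isArcOf? : ∀ i v k → Dec (IsArcOf e c i v k)
  isArcOf? i v k =
    (v F.≟ proj₁ (e i) ×-dec k F.≟ proj₁ (c i)) ⊎-dec (v F.≟ proj₂ (e i) ×-dec k F.≟ proj₂ (c i))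

  IsArcOf-functional : (∀ i → proj₁ (e i) ≢ proj₂ (e i)) →
                       ∀ {i v k k′} → IsArcOf e c i v k → IsArcOf e c i v k′ → k ≡ k′
  IsArcOf-functional loopless (inj₁ (_ , k≡))     (inj₁ (_ , k′≡))    = trans k≡ (sym k′≡)
  IsArcOf-functional loopless (inj₂ (_ , k≡))     (inj₂ (_ , k′≡))    = trans k≡ (sym k′≡)
  IsArcOf-functional loopless (inj₁ (v≡u , _))    (inj₂ (v≡w , _))    = ⊥-elim (loopless _ (trans (sym v≡u) v≡w))
  IsArcOf-functional loopless (inj₂ (v≡w , _))    (inj₁ (v≡u , _))    = ⊥-elim (loopless _ (trans (sym v≡u) v≡w))

  Incident : Fin n → Set
  Incident v = ∃ λ i → ∃ λ k → IsArcOf e c i v k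

  incident? : ∀ v → Dec (Incident v)
  incident? v = any? λ i → any? λ k → isArcOf? i v k

  MissesArcOf : Path m ℓ → Fin n → Set
  MissesArcOf P v = ∃ λ i → ∃ λ k → IsArcOf e c i v k × ¬ (i , k) ∈P P

  missesArcOf? : ∀ P v → Dec (MissesArcOf P v)
  missesArcOf? P v = any? λ i → any? λ k → isArcOf? i v k ×-dec ¬? ((i , k) ∈P? P)

  -- The anchor of v carries flow 1; an isolated vertex is anchored at an arbitrary fixed arc a₀.
  anchor : Arc m ℓ → ∀ v → Dec (Incident v) → Arc m ℓ
  anchor a₀ v (yes (i , k , _)) = i , k
  anchor a₀ v (no _)            = a₀

  InClass : Arc m ℓ → Path m ℓ → Fin n → Set
  InClass a₀ P v = anchor a₀ v (incident? v) ∈P P × ¬ MissesArcOf P v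

  inClass? : ∀ a₀ P v → Dec (InClass a₀ P v)
  inClass? a₀ P v = (anchor a₀ v (incident? v) ∈P? P) ×-dec ¬? (missesArcOf? P v)

  colourClass : Arc m ℓ → Path m ℓ → Subset n
  colourClass a₀ P = tabulate λ v → does (inClass? a₀ P v)

  colourClass⇒InClass : ∀ a₀ P v → lookup (colourClass a₀ P) v ≡ true → InClass a₀ P v
  colourClass⇒InClass a₀ P v v∈S = does⇒ (inClass? a₀ P v) (trans (sym (V.lookup∘tabulate _ v)) v∈S)

  InClass⇒usesArcs : ∀ {a₀ P v} → InClass a₀ P v → ∀ {i k} → IsArcOf e c i v k → (i , k) ∈P P
  InClass⇒usesArcs {P = P} (_ , ¬misses) {i} {k} i-arc with (i , k) ∈P? P
  ... | yes uses  = uses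
  ... | no  ¬uses = ⊥-elim (¬misses (i , k , i-arc , ¬uses))

  colourClass-independent : (∀ i → proj₁ (c i) ≢ proj₂ (c i)) → ∀ a₀ P → Independent e (colourClass a₀ P)
  colourClass-independent distinct a₀ P v w v∈S w∈S (i , same) = distinct i (arcs-on-P same)
    where
    uses : ∀ {u} → u ∈ colourClass a₀ P → ∀ {i k} → IsArcOf e c i u k → (i , k) ∈P P
    uses {u} u∈S = InClass⇒usesArcs {a₀} {P} (colourClass⇒InClass a₀ P u (V.[]=⇒lookup u∈S))
    arcs-on-P : SameEdge (e i) (v , w) → proj₁ (c i) ≡ proj₂ (c i)
    arcs-on-P (inj₁ (e₁≡v , e₂≡w)) = trans (sym (uses v∈S (inj₁ (sym e₁≡v , refl)))) (uses w∈S (inj₂ (sym e₂≡w , refl)))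
    arcs-on-P (inj₂ (e₁≡w , e₂≡v)) = trans (sym (uses w∈S (inj₁ (sym e₁≡w , refl)))) (uses v∈S (inj₂ (sym e₂≡v , refl)))

module _ {n m ℓ : ℕ} {e : Fin m → Fin n × Fin n} (simple : SimpleEdges e)
         {c : Fin m → Fin ℓ × Fin ℓ} (distinct : ∀ i → proj₁ (c i) ≢ proj₂ (c i)) (a₀ : Arc m ℓ)
         {x : Path m ℓ → ℚ} (isFlow : IsPathFlow x) (value : flowValue x ≡ ℕtoℚ ℓ)
         (cliques : ∀ S → Clique2 e c S → lam x S ≤ℚ 1ℚ) where

  usesAnchor∧misses⇒x≡0 : ∀ v (d : Dec (Incident e c v)) P →
                       anchor e c a₀ v d ∈P P → MissesArcOf e c P v → x P ≡ 0ℚ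
  usesAnchor∧misses⇒x≡0 v (no ¬incident) P _ (i , k , i-arc , _) = ⊥-elim (¬incident (i , k , i-arc))
  usesAnchor∧misses⇒x≡0 v (yes (j , k₀ , j-arc)) P uses-anchor (i , k , i-arc , ¬uses) with j F.≟ i
  ... | yes refl = ⊥-elim (¬uses (trans uses-anchor (IsArcOf-functional e c (proj₁ simple) j-arc i-arc)))
  ... | no  j≢i  = load≡1∧λ≤1⇒x≡0 x (proj₁ isFlow) (j , k₀) (i , k)
                     (maxFlow⇒load≡1 x isFlow value (i , k))
                     (cliques _ (pair (j , k₀) (i , k) (j≢i , v , j-arc , i-arc))) P uses-anchor ¬uses

  colourClass-cover : ∀ v → ∑[ P ∈ allPaths m ℓ ] 𝟙[ lookup (colourClass e c a₀ P) v ] x P ≡ 1ℚ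
  colourClass-cover v =
    trans (∑-cong (allPaths m ℓ) class≈anchor) (maxFlow⇒load≡1 x isFlow value (anchor e c a₀ v (incident? e c v)))
    where
    class≈anchor : ∀ P → 𝟙[ lookup (colourClass e c a₀ P) v ] x P
                         ≡ 𝟙[ does (anchor e c a₀ v (incident? e c v) ∈P? P) ] x P
    class≈anchor P = trans (cong (λ b → 𝟙[ b ] x P) (V.lookup∘tabulate _ v))
      (𝟙-∧-not _ _ (x P) λ uses misses →
         usesAnchor∧misses⇒x≡0 v (incident? e c v) P (does⇒ (_ ∈P? P) uses) (does⇒ (missesArcOf? e c P v) misses))

  maxFlow⇒fracChromLe : FracChromLe e ℓ
  maxFlow⇒fracChromLe =
    fracChromLe-fromFamily e ℓ (allPaths m ℓ) x (colourClass e c a₀) (proj₁ isFlow)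
      (colourClass-independent e c distinct a₀) colourClass-cover (≤-reflexive value)

module _ {n m ℓ′ : ℕ} {e : Fin m → Fin n × Fin n} {c : Fin m → Fin (suc (suc ℓ′)) × Fin (suc (suc ℓ′))}
         (distinct : ∀ i → proj₁ (c i) ≢ proj₂ (c i)) (colouring : ExactColouring e (suc (suc ℓ′))) where

  open ExactColouring colouring

  private
    ℓ : ℕ
    ℓ = suc (suc ℓ′)
    Is = allSubsets n
    paths = allPaths m ℓ
    u w : Fin m → Fin n
    u i = proj₁ (e i)
    w i = proj₂ (e i)
    cu cw : Fin m → Fin ℓ
    cu i = proj₁ (c i)
    cw i = proj₂ (c i)

  p+1+1≡ℓ⇒p≡ℓ′ : ∀ p → p + 1ℚ + 1ℚ ≡ ℕtoℚ ℓ → p ≡ ℕtoℚ ℓ′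
  p+1+1≡ℓ⇒p≡ℓ′ p p+2≡ℓ = ∙-cancelʳ 1ℚ _ _ (∙-cancelʳ 1ℚ _ _ (trans p+2≡ℓ ℓ≡ℓ′+1+1))
    where
    ℓ≡ℓ′+1+1 : ℕtoℚ ℓ ≡ ℕtoℚ ℓ′ + 1ℚ + 1ℚ
    ℓ≡ℓ′+1+1 = trans (ℕtoℚ-suc (suc ℓ′)) (trans (cong (1ℚ +_) (ℕtoℚ-suc ℓ′))
                 (solve 2 (λ a b → a :+ (a :+ b) := b :+ a :+ a) refl 1ℚ (ℕtoℚ ℓ′)))

  Skips : Subset n → Fin m → Bool
  Skips I i = not (lookup I (u i)) ∧ not (lookup I (w i))

  ∑-skipping-weight : ∀ i → ∑[ I ∈ Is ] 𝟙[ Skips I i ] weight I ≡ ℕtoℚ ℓ′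
  ∑-skipping-weight i = p+1+1≡ℓ⇒p≡ℓ′ skipping (begin
    skipping + 1ℚ + 1ℚ
      ≡⟨ cong₂ (λ p q → skipping + p + q) (weight-cover (u i)) (weight-cover (w i)) ⟨
    skipping + (∑[ I ∈ Is ] 𝟙[ lookup I (u i) ] weight I) + (∑[ I ∈ Is ] 𝟙[ lookup I (w i) ] weight I)
      ≡⟨ ∑-partition Is (λ I → lookup I (u i)) (λ I → lookup I (w i)) weight uw-free ⟩
    ∑ Is weight
      ≡⟨ weight-total ⟩
    ℕtoℚ ℓ ∎)
    where
    open ≡-Reasoning
    skipping = ∑[ I ∈ Is ] 𝟙[ Skips I i ] weight I
    uw-free : ∀ I → 𝟙[ lookup I (u i) ∧ lookup I (w i) ] weight I ≡ 0ℚ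
    uw-free I with lookup I (u i) in u∈I | lookup I (w i) in w∈I
    ... | true  | true  = weight-edge i I u∈I w∈I
    ... | true  | false = refl
    ... | false | _     = refl

  IsFiller : Fin m → Fin ℓ → Bool
  IsFiller i t = not (does (t F.≟ cu i)) ∧ not (does (t F.≟ cw i))

  ∑-fillers : ∀ i → ∑[ t ∈ allFin ℓ ] 𝟙[ IsFiller i t ] 1ℚ ≡ ℕtoℚ ℓ′
  ∑-fillers i = p+1+1≡ℓ⇒p≡ℓ′ fillers (begin
    fillers + 1ℚ + 1ℚ
      ≡⟨ cong₂ (λ p q → fillers + p + q) (sift (allFin-isEnumeration ℓ) (cu i) (λ _ → 1ℚ))
                                         (sift (allFin-isEnumeration ℓ) (cw i) (λ _ → 1ℚ)) ⟨
    fillers + (∑[ t ∈ allFin ℓ ] 𝟙[ does (t F.≟ cu i) ] 1ℚ) + (∑[ t ∈ allFin ℓ ] 𝟙[ does (t F.≟ cw i) ] 1ℚ)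
      ≡⟨ ∑-partition (allFin ℓ) (λ t → does (t F.≟ cu i)) (λ t → does (t F.≟ cw i)) (λ _ → 1ℚ) cu-cw-free ⟩
    ∑[ t ∈ allFin ℓ ] 1ℚ
      ≡⟨ ∑-allFin-1 ℓ ⟩
    ℕtoℚ ℓ ∎)
    where
    open ≡-Reasoning
    fillers = ∑[ t ∈ allFin ℓ ] 𝟙[ IsFiller i t ] 1ℚ
    cu-cw-free : ∀ t → 𝟙[ does (t F.≟ cu i) ∧ does (t F.≟ cw i) ] 1ℚ ≡ 0ℚ
    cu-cw-free t with t F.≟ cu i | t F.≟ cw i
    ... | yes refl | yes t≡cw = ⊥-elim (distinct i t≡cw)
    ... | yes _    | no  _    = refl
    ... | no  _    | _        = refl

  bundleShare : (u∈I w∈I at-u at-w : Bool) → ℚ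
  bundleShare true  _     at-u _    = 𝟙[ at-u ] 1ℚ
  bundleShare false true  _    at-w = 𝟙[ at-w ] 1ℚ
  bundleShare false false at-u at-w = 𝟙[ not at-u ∧ not at-w ] inv ℓ′

  bundleDist : Subset n → Fin m → Fin ℓ → ℚ
  bundleDist I i t = bundleShare (lookup I (u i)) (lookup I (w i)) (does (t F.≟ cu i)) (does (t F.≟ cw i))

  bundleDist-nonNeg : ∀ I i t → 0ℚ ≤ℚ bundleDist I i t
  bundleDist-nonNeg I i t = nonNeg (lookup I (u i)) (lookup I (w i)) _ _
    where
    nonNeg : ∀ a b at-u at-w → 0ℚ ≤ℚ bundleShare a b at-u at-w
    nonNeg true  _     at-u _    = 𝟙-nonNeg at-u 0≤1
    nonNeg false true  _    at-w = 𝟙-nonNeg at-w 0≤1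
    nonNeg false false at-u at-w = 𝟙-nonNeg (not at-u ∧ not at-w) (inv-nonNeg ℓ′)

  bundleDist-at-u : ∀ I i → bundleDist I i (cu i) ≡ 𝟙[ lookup I (u i) ] 1ℚ
  bundleDist-at-u I i =
    trans (cong₂ (bundleShare (lookup I (u i)) (lookup I (w i))) (dec-true (cu i F.≟ cu i) refl)
                 (dec-false (cu i F.≟ cw i) (distinct i)))
          (at-u (lookup I (u i)) (lookup I (w i)))
    where
    at-u : ∀ a b → bundleShare a b true false ≡ 𝟙[ a ] 1ℚ
    at-u true  _     = refl
    at-u false true  = refl
    at-u false false = refl

  bundleDist-at-w : ∀ I i → bundleDist I i (cw i) ≡ 𝟙[ not (lookup I (u i)) ∧ lookup I (w i) ] 1ℚ
  bundleDist-at-w I i =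
    trans (cong₂ (bundleShare (lookup I (u i)) (lookup I (w i))) (dec-false (cw i F.≟ cu i) (distinct i ∘ sym))
                 (dec-true (cw i F.≟ cw i) refl))
          (at-w (lookup I (u i)) (lookup I (w i)))
    where
    at-w : ∀ a b → bundleShare a b false true ≡ 𝟙[ not a ∧ b ] 1ℚ
    at-w true  _     = refl
    at-w false true  = refl
    at-w false false = refl

  bundleDist-at-filler : ∀ I i t → t ≢ cu i → t ≢ cw i → bundleDist I i t ≡ 𝟙[ Skips I i ] inv ℓ′
  bundleDist-at-filler I i t t≢cu t≢cw =
    trans (cong₂ (bundleShare (lookup I (u i)) (lookup I (w i))) (dec-false (t F.≟ cu i) t≢cu)
                 (dec-false (t F.≟ cw i) t≢cw))
          (at-filler (lookup I (u i)) (lookup I (w i)))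
    where
    at-filler : ∀ a b → bundleShare a b false false ≡ 𝟙[ not a ∧ not b ] inv ℓ′
    at-filler true  _     = refl
    at-filler false true  = refl
    at-filler false false = refl

  bundleDist-absent : ∀ I {i v k} → IsArcOf e c i v k → lookup I v ≡ false → bundleDist I i k ≡ 0ℚ
  bundleDist-absent I {i} (inj₁ (refl , refl)) v∉I =
    trans (bundleDist-at-u I i) (cong (λ b → 𝟙[ b ] 1ℚ) v∉I)
  bundleDist-absent I {i} (inj₂ (refl , refl)) v∉I =
    trans (bundleDist-at-w I i) (cong (λ b → 𝟙[ b ] 1ℚ) (trans (cong (not (lookup I (u i)) ∧_) v∉I) (B.∧-zeroʳ _)))

  ∑-bundleShare : ∀ i a b → a ∨ b ≡ true ⊎ 1 ≤ ℓ′ →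
                  ∑[ t ∈ allFin ℓ ] bundleShare a b (does (t F.≟ cu i)) (does (t F.≟ cw i)) ≡ 1ℚ
  ∑-bundleShare i true  _    _ = sift (allFin-isEnumeration ℓ) (cu i) (λ _ → 1ℚ)
  ∑-bundleShare i false true _ = sift (allFin-isEnumeration ℓ) (cw i) (λ _ → 1ℚ)
  ∑-bundleShare i false false (inj₂ 1≤ℓ′) = begin
    ∑[ t ∈ allFin ℓ ] 𝟙[ IsFiller i t ] inv ℓ′         ≡⟨ ∑-cong (allFin ℓ) (λ t → 𝟙-as-* (IsFiller i t) (inv ℓ′)) ⟩
    ∑[ t ∈ allFin ℓ ] (inv ℓ′ * 𝟙[ IsFiller i t ] 1ℚ)  ≡⟨ ∑-*ˡ (allFin ℓ) (inv ℓ′) _ ⟩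
    inv ℓ′ * (∑[ t ∈ allFin ℓ ] 𝟙[ IsFiller i t ] 1ℚ)  ≡⟨ cong (inv ℓ′ *_) (∑-fillers i) ⟩
    inv ℓ′ * ℕtoℚ ℓ′                                   ≡⟨ inv-*-pos 1≤ℓ′ ⟩
    1ℚ                                                 ∎
    where
    open ≡-Reasoning
    inv-*-pos : ∀ {k} → 1 ≤ k → inv k * ℕtoℚ k ≡ 1ℚ
    inv-*-pos {suc k} _ = inv-*-suc k

  -- For ℓ = 2 there are no filler arcs, but then the classes skipping an edge have no weight.
  bundles-or-null : ∀ I → (∀ i → ∑ (allFin ℓ) (bundleDist I i) ≡ 1ℚ) ⊎ weight I ≡ 0ℚ
  bundles-or-null I with ℓ′ ℕ.≟ 0 | any? (λ i → Skips I i B.≟ true)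
  ... | no ℓ′≢0 | _ = inj₁ λ i → ∑-bundleShare i (lookup I (u i)) (lookup I (w i)) (inj₂ (ℕ.n≢0⇒n>0 ℓ′≢0))
  ... | yes _   | no ¬skip =
    inj₁ λ i → ∑-bundleShare i (lookup I (u i)) (lookup I (w i)) (inj₁ (meets (lookup I (u i)) (lookup I (w i)) (¬skip ∘ (i ,_))))
    where
    meets : ∀ a b → not a ∧ not b ≢ true → a ∨ b ≡ true
    meets true  _     _     = refl
    meets false true  _     = refl
    meets false false ¬skip = ⊥-elim (¬skip refl)
  ... | yes ℓ′≡0 | yes (i , skips) = inj₂ (≤-antisym weight≤0 (weight-nonNeg I))
    where
    weight≤0 : weight I ≤ℚ 0ℚ
    weight≤0 = begin
      weight I                                 ≡⟨ cong (λ b → 𝟙[ b ] weight I) skips ⟨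
      𝟙[ Skips I i ] weight I                  ≤⟨ term≤∑ (allSubsets-isEnumeration n) (λ J → 𝟙-nonNeg (Skips J i) (weight-nonNeg J)) I ⟩
      ∑[ J ∈ Is ] 𝟙[ Skips J i ] weight J      ≡⟨ trans (∑-skipping-weight i) (cong ℕtoℚ ℓ′≡0) ⟩
      0ℚ                                       ∎
      where open ≤-Reasoning

  flow : Path m ℓ → ℚ
  flow P = ∑[ I ∈ Is ] weight I * productWeight (bundleDist I) P

  flow-nonNeg : ∀ P → 0ℚ ≤ℚ flow P
  flow-nonNeg P = ∑-nonNeg Is λ I →
    *-nonNeg (weight-nonNeg I) (productWeight-nonNeg (bundleDist I) (bundleDist-nonNeg I) P)

  ∑-flow : ∀ (E : Path m ℓ → Bool) →
           ∑[ P ∈ paths ] 𝟙[ E P ] flow P ≡ ∑[ I ∈ Is ] weight I * (∑[ P ∈ paths ] 𝟙[ E P ] productWeight (bundleDist I) P)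
  ∑-flow E = begin
    ∑[ P ∈ paths ] 𝟙[ E P ] flow P
      ≡⟨ ∑-cong paths (λ P → 𝟙-∑ (E P) Is _) ⟩
    ∑[ P ∈ paths ] ∑[ I ∈ Is ] 𝟙[ E P ] (weight I * productWeight (bundleDist I) P)
      ≡⟨ ∑-comm paths Is _ ⟩
    ∑[ I ∈ Is ] ∑[ P ∈ paths ] 𝟙[ E P ] (weight I * productWeight (bundleDist I) P)
      ≡⟨ ∑-cong Is (λ I → trans (∑-cong paths (λ P → 𝟙-*ˡ (E P) (weight I) _)) (∑-*ˡ paths (weight I) _)) ⟩
    ∑[ I ∈ Is ] weight I * (∑[ P ∈ paths ] 𝟙[ E P ] productWeight (bundleDist I) P) ∎
    where open ≡-Reasoning

  weighted-mass : ∀ I → weight I * ∑ paths (productWeight (bundleDist I)) ≡ weight I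
  weighted-mass I with bundles-or-null I
  ... | inj₁ ∑≡1 = trans (cong (weight I *_) (∑-productWeight (allFin ℓ) m (bundleDist I) ∑≡1)) (*-identityʳ _)
  ... | inj₂ null = trans (≡0⇒*-const null _ 1ℚ) (*-identityʳ _)

  weighted-marginal : ∀ I i k →
    weight I * (∑[ P ∈ paths ] 𝟙[ does (lookup P i F.≟ k) ] productWeight (bundleDist I) P) ≡ weight I * bundleDist I i k
  weighted-marginal I i k with bundles-or-null I
  ... | inj₁ ∑≡1 = cong (weight I *_)
                     (∑-productWeight-marginal (allFin ℓ) (allFin-isEnumeration ℓ) m (bundleDist I) ∑≡1 i k)
  ... | inj₂ null = ≡0⇒*-const null _ _

  flow-value : flowValue flow ≡ ℕtoℚ ℓ
  flow-value = trans (∑-flow (λ _ → true)) (trans (∑-cong Is weighted-mass) weight-total)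

  load-flow : ∀ i k → load flow (i , k) ≡ ∑[ I ∈ Is ] weight I * bundleDist I i k
  load-flow i k = trans (∑-flow (λ P → does (lookup P i F.≟ k))) (∑-cong Is (λ I → weighted-marginal I i k))

  load-flow≤1 : ∀ a → load flow a ≤ℚ 1ℚ
  load-flow≤1 (i , k) with k F.≟ cu i | k F.≟ cw i
  ... | yes refl | _ = begin
    load flow (i , cu i)                             ≡⟨ load-flow i (cu i) ⟩
    ∑[ I ∈ Is ] weight I * bundleDist I i (cu i)      ≡⟨ ∑-cong Is (λ I → trans (cong (weight I *_) (bundleDist-at-u I i))
                                                                          (sym (𝟙-as-* (lookup I (u i)) (weight I)))) ⟩
    ∑[ I ∈ Is ] 𝟙[ lookup I (u i) ] weight I          ≡⟨ weight-cover (u i) ⟩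
    1ℚ                                               ∎
    where open ≤-Reasoning
  ... | no _ | yes refl = begin
    load flow (i , cw i)                             ≡⟨ load-flow i (cw i) ⟩
    ∑[ I ∈ Is ] weight I * bundleDist I i (cw i)      ≡⟨ ∑-cong Is (λ I → trans (cong (weight I *_) (bundleDist-at-w I i))
                                                                          (sym (𝟙-as-* (not (lookup I (u i)) ∧ lookup I (w i)) (weight I)))) ⟩
    ∑[ I ∈ Is ] 𝟙[ not (lookup I (u i)) ∧ lookup I (w i) ] weight I
                                                     ≤⟨ ∑-mono-≤ Is (λ I → 𝟙-∧-≤ (not (lookup I (u i))) _ (weight-nonNeg I)) ⟩
    ∑[ I ∈ Is ] 𝟙[ lookup I (w i) ] weight I          ≡⟨ weight-cover (w i) ⟩
    1ℚ                                               ∎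
    where open ≤-Reasoning
  ... | no k≢cu | no k≢cw = begin
    load flow (i , k)                                ≡⟨ load-flow i k ⟩
    ∑[ I ∈ Is ] weight I * bundleDist I i k           ≡⟨ ∑-cong Is (λ I → trans (cong (weight I *_) (bundleDist-at-filler I i k k≢cu k≢cw))
                                                                          (*-𝟙-swap (Skips I i) (weight I) (inv ℓ′))) ⟩
    ∑[ I ∈ Is ] inv ℓ′ * 𝟙[ Skips I i ] weight I      ≡⟨ ∑-*ˡ Is (inv ℓ′) _ ⟩
    inv ℓ′ * (∑[ I ∈ Is ] 𝟙[ Skips I i ] weight I)    ≡⟨ cong (inv ℓ′ *_) (∑-skipping-weight i) ⟩
    inv ℓ′ * ℕtoℚ ℓ′                                 ≤⟨ inv-*≤1 ℓ′ ⟩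
    1ℚ                                               ∎
    where open ≤-Reasoning

  flow-isPathFlow : IsPathFlow flow
  flow-isPathFlow = flow-nonNeg , λ a → ≤-trans (≤-reflexive (∑-filter (a ∈P?_) paths flow)) (load-flow≤1 a)

  -- A class containing v carries its weight at most once, and one missing v never uses a_{iv} or a_{jv}.
  pair-share : ∀ I {i k j k′ v} → IsArcOf e c i v k → IsArcOf e c j v k′ →
    weight I * (∑[ P ∈ paths ] 𝟙[ does (lookup P i F.≟ k) ∨ (does (lookup P j F.≟ k′) ∨ false) ] productWeight (bundleDist I) P)
      ≤ℚ 𝟙[ lookup I v ] weight I
  pair-share I {i} {k} {j} {k′} {v} i-arc j-arc = bound (lookup I v) refl
    where
    A B : Path m ℓ → Bool
    A P = does (lookup P i F.≟ k)
    B P = does (lookup P j F.≟ k′)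
    pw = productWeight (bundleDist I)
    pw≥0 = productWeight-nonNeg (bundleDist I) (bundleDist-nonNeg I)
    instance _ = nonNegative (weight-nonNeg I)
    open ≤-Reasoning

    bound : ∀ b → lookup I v ≡ b → weight I * (∑[ P ∈ paths ] 𝟙[ A P ∨ (B P ∨ false) ] pw P) ≤ℚ 𝟙[ b ] weight I
    bound true _ = begin
      weight I * (∑[ P ∈ paths ] 𝟙[ A P ∨ (B P ∨ false) ] pw P)
        ≤⟨ *-monoˡ-≤-nonNeg (weight I) (∑-mono-≤ paths (λ P → 𝟙-≤ (A P ∨ (B P ∨ false)) (pw≥0 P))) ⟩
      weight I * ∑ paths pw
        ≡⟨ weighted-mass I ⟩
      weight I ∎
    bound false v∉I = begin
      weight I * (∑[ P ∈ paths ] 𝟙[ A P ∨ (B P ∨ false) ] pw P)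
        ≤⟨ *-monoˡ-≤-nonNeg (weight I) (∑-mono-≤ paths (λ P →
             ≤-trans (𝟙-∨-≤ (A P) _ (pw≥0 P)) (+-monoʳ-≤ (𝟙[ A P ] pw P) (≤-reflexive (cong (λ b → 𝟙[ b ] pw P) (B.∨-identityʳ (B P))))))) ⟩
      weight I * (∑[ P ∈ paths ] (𝟙[ A P ] pw P + 𝟙[ B P ] pw P))
        ≡⟨ cong (weight I *_) (∑-distrib-+ paths _ _) ⟩
      weight I * ((∑[ P ∈ paths ] 𝟙[ A P ] pw P) + (∑[ P ∈ paths ] 𝟙[ B P ] pw P))
        ≡⟨ *-distribˡ-+ (weight I) _ _ ⟩
      weight I * (∑[ P ∈ paths ] 𝟙[ A P ] pw P) + weight I * (∑[ P ∈ paths ] 𝟙[ B P ] pw P)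
        ≡⟨ cong₂ _+_ (weighted-marginal I i k) (weighted-marginal I j k′) ⟩
      weight I * bundleDist I i k + weight I * bundleDist I j k′
        ≡⟨ cong₂ (λ p q → weight I * p + weight I * q) (bundleDist-absent I i-arc v∉I) (bundleDist-absent I j-arc v∉I) ⟩
      weight I * 0ℚ + weight I * 0ℚ
        ≡⟨ cong₂ _+_ (*-zeroʳ (weight I)) (*-zeroʳ (weight I)) ⟩
      0ℚ ∎

  flow-cliques : ∀ S → Clique2 e c S → lam flow S ≤ℚ 1ℚ
  flow-cliques .[] empty = ≤-trans (≤-reflexive (trans (∑-filter _ paths flow) (∑-zero paths))) 0≤1
  flow-cliques .(a ∷ []) (single a) = ≤-trans (≤-reflexive (lam-single flow a)) (load-flow≤1 a)
  flow-cliques .((i , k) ∷ (j , k′) ∷ []) (pair (i , k) (j , k′) (_ , v , i-arc , j-arc)) = begin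
    lam flow ((i , k) ∷ (j , k′) ∷ [])
      ≡⟨ trans (∑-filter _ paths flow) (∑-flow (λ P → does (lookup P i F.≟ k) ∨ (does (lookup P j F.≟ k′) ∨ false))) ⟩
    ∑[ I ∈ Is ] weight I * (∑[ P ∈ paths ] 𝟙[ does (lookup P i F.≟ k) ∨ (does (lookup P j F.≟ k′) ∨ false) ]
                                              productWeight (bundleDist I) P)
      ≤⟨ ∑-mono-≤ Is (λ I → pair-share I i-arc j-arc) ⟩
    ∑[ I ∈ Is ] 𝟙[ lookup I v ] weight I
      ≡⟨ weight-cover v ⟩
    1ℚ ∎
    where open ≤-Reasoning

  exactColouring⇒maxFlow : Σ (Path m ℓ → ℚ) λ x → IsPathFlow x × flowValue x ≡ ℕtoℚ ℓ
                             × (∀ S → Clique2 e c S → lam x S ≤ℚ 1ℚ)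
  exactColouring⇒maxFlow = flow , flow-isPathFlow , flow-value , flow-cliques

lemma1 : (n m ℓ : ℕ) → 2 ≤ ℓ
    → (e : Fin m → Fin n × Fin n) → SimpleEdges e
    → (c : Fin m → Fin ℓ × Fin ℓ) → (∀ i → proj₁ (c i) ≢ proj₂ (c i))
    → (Σ (Path m ℓ → ℚ) λ x →
         IsPathFlow x × flowValue x ≡ ℕtoℚ ℓ
         × (∀ (S : List (Arc m ℓ)) → Clique2 e c S → lam x S ≤ℚ 1ℚ))
      ⇔ FracChromLe e ℓ
lemma1 n zero    (suc (suc ℓ′)) (s≤s (s≤s _)) e simple c distinct =
  mk⇔ (λ _ → edgeless⇒fracChromLe n (suc ℓ′) e)
      (exactColouring⇒maxFlow distinct ∘ fracChromLe⇒exactColouring)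
lemma1 n (suc m) (suc (suc ℓ′)) (s≤s (s≤s _)) e simple c distinct =
  mk⇔ (λ (x , isFlow , value , cliques) → maxFlow⇒fracChromLe simple distinct (F.zero , F.zero) isFlow value cliques)
      (exactColouring⇒maxFlow distinct ∘ fracChromLe⇒exactColouring)
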